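{- Let $\phi$ be the Boolean formula $v_1\wedge v_2\wedge v_3$. There does not exist an $X\in\mathcal{IS}^{0,0}_{br}$ in which the termination instruction $!$ occurs at most once and the basic instruction $\mathtt{out}.\mathtt{set{:}F}$ does not occur such that $X$ computes the Boolean function induced by $\phi$.
   Context: Let $\mathbb B=\{\mathsf T,\mathsf F\}$. There are Boolean registers named $\mathtt{in}{:}i$ ($i\ge1$), $\mathtt{aux}{:}i$ ($i\ge1$) and $\mathtt{out}$, processing methods $\mathtt{set{:}T}$ (content becomes $\mathsf T$, reply $\mathsf T$), $\mathtt{set{:}F}$ (content becomes $\mathsf F$, reply $\mathsf F$), $\mathtt{get}$ (no change, reply is the content). Basic instructions are $f.m$ ($f$ register name, $m$ method). Primitive instructions: for each basic instruction $a$, the plain instruction $a$, positive test $+a$, negative test $-a$; forward jumps $\#l$ ($l\in\mathbb N$); termination $!$. An instruction sequence is a finite non-empty sequence $X=u_1;\dots;u_k$ of primitive instructions. Execution starts at $u_1$: $a$ executes $a$ and proceeds with the next instruction; $+a$ executes $a$ and proceeds with the next instruction if the reply is $\mathsf T$, otherwise skips the next instruction and proceeds with the one after; $-a$ likewise with reply roles reversed; $\#l$ proceeds with the $l$-th next instruction ($\#0$ causes inaction); $!$ terminates; if there is no instruction to proceed with, inaction occurs. $\mathcal{IS}_{br}$ is the set of instruction sequences whose basic instructions are all of the forms $\mathtt{in}{:}i.\mathtt{get}$, $\mathtt{aux}{:}i.\mathtt{get}$, $\mathtt{aux}{:}i.\mathtt{set{:}}b$, $\mathtt{out}.\mathtt{set{:}}b$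 ($b\in\mathbb B$); $\mathcal{IS}^{0,0}_{br}$ is the set of $X\in\mathcal{IS}_{br}$ in which no instruction on an auxiliary register and no jump $\#l$ with $l>0$ occurs. $X$ computes $f:\mathbb B^n\to\mathbb B$ if for all $b_1,\dots,b_n$, executing $X$ with $\mathtt{in}{:}i$ initially $b_i$ ($i\le n$) and all auxiliary registers and $\mathtt{out}$ initially $\mathsf F$, execution never executes an instruction on $\mathtt{in}{:}i$ with $i>n$, ends by executing $!$, and leaves $f(b_1,\dots,b_n)$ in $\mathtt{out}$. For a Boolean formula $\phi$ containing the variables $v_1,\dots,v_n$, the Boolean function induced by $\phi$ is $f:\mathbb B^n\to\mathbb B$ with $f(b_1,\dots,b_n)=\mathsf T$ iff $\phi$ is satisfied by the assignment $v_i\mapsto b_i$. -}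

module Defs where

open import Data.Bool using (Bool; true; false; _∧_; _∨_; not)
open import Data.Nat using (ℕ; zero; suc; _≤_; _+_; _≟_; _≤?_; _<_)
open import Data.Fin using (Fin; zero; suc; fromℕ<)
open import Data.Vec using (Vec; lookup)
open import Data.List using (List; []; _∷_; length; drop)
open import Data.List.Relation.Unary.All using (All)
open import Data.Product using (Σ; _×_; _,_; proj₁; proj₂)
open import Data.Maybe using (Maybe; just; nothing)
open import Data.Empty using (⊥)
open import Relation.Binary.PropositionalEquality using (_≡_; _≢_)
open import Relation.Nullary using (¬_; yes; no)
open import Data.Unit using (⊤)

-- Register names: in:i, aux:i (the index is the paper's i; i = 0 is excluded by IS-br), out.
data Reg : Set where
  inR  : ℕ → Reg
  auxR : ℕ → Reg
  outR : Reg

data Method : Set where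
  setT setF get : Method

record Basic : Set where
  constructor _∙_
  field
    reg    : Reg
    method : Method

data Instr : Set where
  plain : Basic → Instr
  ptest : Basic → Instr
  ntest : Basic → Instr
  jump  : ℕ → Instr
  halt  : Instr

InstrSeq : Set
InstrSeq = List Instr

NonEmpty : InstrSeq → Set
NonEmpty X = X ≢ []

data AllowedBasic : Basic → Set where
  in-get  : ∀ i → 1 ≤ i → AllowedBasic (inR i ∙ get)
  aux-get : ∀ i → 1 ≤ i → AllowedBasic (auxR i ∙ get)
  aux-setT : ∀ i → 1 ≤ i → AllowedBasic (auxR i ∙ setT)
  aux-setF : ∀ i → 1 ≤ i → AllowedBasic (auxR i ∙ setF)
  out-setT : AllowedBasic (outR ∙ setT)
  out-setF : AllowedBasic (outR ∙ setF)

BasicsOf : (Basic → Set) → Instr → Set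
BasicsOf P (plain a) = P a
BasicsOf P (ptest a) = P a
BasicsOf P (ntest a) = P a
BasicsOf P (jump l)  = ⊤
BasicsOf P halt      = ⊤

IS-br : InstrSeq → Set
IS-br X = NonEmpty X × All (BasicsOf AllowedBasic) X

NotAux : Basic → Set
NotAux (auxR i ∙ m) = ⊥
NotAux (inR i ∙ m)  = ⊤
NotAux (outR ∙ m)   = ⊤

NoPosJump : Instr → Set
NoPosJump (jump zero)    = ⊤
NoPosJump (jump (suc l)) = ⊥
NoPosJump _              = ⊤

IS-br⁰⁰ : InstrSeq → Set
IS-br⁰⁰ X = IS-br X × All (BasicsOf NotAux) X × All NoPosJump X

countHalt : InstrSeq → ℕ
countHalt []          = zero
countHalt (halt ∷ X)  = suc (countHalt X)
countHalt (_ ∷ X)     = countHalt X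

DoesNotOccur : Basic → InstrSeq → Set
DoesNotOccur b X = All (BasicsOf (λ a → a ≢ b)) X

record State : Set where
  constructor st
  field
    inS  : ℕ → Bool
    auxS : ℕ → Bool
    outS : Bool
open State public

update : (ℕ → Bool) → ℕ → Bool → ℕ → Bool
update f i b j with i ≟ j
... | yes _ = b
... | no  _ = f j

-- effect of a method on a register content: (new content , reply)
applyM : Method → Bool → Bool × Bool
applyM setT _ = true , true
applyM setF _ = false , false
applyM get  c = c , c

data Outcome : Set where
  terminated : State → Outcome
  inaction   : Outcome
  illegal    : Outcome
  outOfFuel  : Outcome

execBasic : ℕ → Basic → State → Maybe (State × Bool)
execBasic n (inR i ∙ m) s with 1 ≤? i | i ≤? n
... | yes _ | yes _ = let r = applyM m (inS s i) in
                      just (record s { inS = update (inS s) i (proj₁ r) } , proj₂ r)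
... | _ | _ = nothing
execBasic n (auxR i ∙ m) s = let r = applyM m (auxS s i) in
                      just (record s { auxS = update (auxS s) i (proj₁ r) } , proj₂ r)
execBasic n (outR ∙ m) s = let r = applyM m (outS s) in
                      just (record s { outS = proj₁ r } , proj₂ r)

-- run: fuel, number of inputs, remaining instruction sequence (current instruction first), state
run : ℕ → ℕ → InstrSeq → State → Outcome
run zero    n X s = outOfFuel
run (suc k) n [] s = inaction
run (suc k) n (halt ∷ X) s = terminated s
run (suc k) n (jump zero ∷ X) s = inaction
run (suc k) n (jump (suc l) ∷ X) s = run k n (drop l X) s
run (suc k) n (plain a ∷ X) s with execBasic n a s
... | nothing = illegal
... | just (s' , _) = run k n X s'
run (suc k) n (ptest a ∷ X) s with execBasic n a s
... | nothing = illegal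
... | just (s' , true)  = run k n X s'
... | just (s' , false) = run k n (drop 1 X) s'
run (suc k) n (ntest a ∷ X) s with execBasic n a s
... | nothing = illegal
... | just (s' , false) = run k n X s'
... | just (s' , true)  = run k n (drop 1 X) s'

initState : ∀ {n} → Vec Bool n → State
initState {n} bs = st inVal (λ _ → false) false
  where
  inVal : ℕ → Bool
  inVal zero    = false
  inVal (suc j) with suc j ≤? n
  ... | yes p = lookup bs (fromℕ< p)
  ... | no  _ = false

-- X computes f : 𝔹ⁿ → 𝔹.  Execution moves strictly forward, so length X + 1 steps suffice.
Computes : (n : ℕ) → (Vec Bool n → Bool) → InstrSeq → Set
Computes n f X = (bs : Vec Bool n) →
  Σ State λ s → run (suc (length X)) n X (initState bs) ≡ terminated s × outS s ≡ f bs

-- Boolean formulas over variables v_1 .. v_n (variable v_{i+1} is var i)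

data Formula (n : ℕ) : Set where
  var  : Fin n → Formula n
  ⊤ᶠ ⊥ᶠ : Formula n
  ¬ᶠ_  : Formula n → Formula n
  _∧ᶠ_ _∨ᶠ_ : Formula n → Formula n → Formula n

satisfies : ∀ {n} → Vec Bool n → Formula n → Bool
satisfies ρ (var i)   = lookup ρ i
satisfies ρ ⊤ᶠ        = true
satisfies ρ ⊥ᶠ        = false
satisfies ρ (¬ᶠ φ)    = not (satisfies ρ φ)
satisfies ρ (φ ∧ᶠ ψ)  = satisfies ρ φ ∧ satisfies ρ ψ
satisfies ρ (φ ∨ᶠ ψ)  = satisfies ρ φ ∨ satisfies ρ ψ

induced : ∀ {n} → Formula n → Vec Bool n → Bool
induced φ bs = satisfies bs φ

φ₃ : Formula 3
φ₃ = (var zero ∧ᶠ var (suc zero)) ∧ᶠ var (suc (suc zero))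

-- The programs considered never jump forward, so an execution only ever skips
-- the next instruction after a test.  Follow the executions on all inputs at
-- once, each positioned at the head of the remaining program or about to skip
-- its first instruction.  At an instruction in:i.get, a rejected input with
-- v_i = F and one with v_i = T (for v₁ ∧ v₂ ∧ v₃: 000 and the unit vector e_i)
-- receive different replies, and no test skips on both replies, so some
-- rejected execution is always at the head.  That execution cannot meet #0, a
-- missing input, or out.set:T (out could then never return to F); hence the
-- program consists of input reads up to the first !.  But an accepted
-- execution reaching that ! at the head still has out = F, and one skipping it
-- finds no further !.
module Submission where

open import Defs
open import Data.Nat using (_≤_)
open import Data.Product using (Σ; _×_)
open import Relation.Nullary using (¬_)

open import Data.Bool using (Bool; true; false)
open import Data.Empty using (⊥-elim)
open import Data.Fin using (Fin; zero; suc; fromℕ<)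
open import Data.List using ([]; _∷_; drop; length)
open import Data.List.Relation.Unary.All using (All; []; _∷_)
open import Data.List.Relation.Unary.All.Properties using (drop⁺)
open import Data.Maybe using (Maybe; just; nothing)
open import Data.Nat using (ℕ; zero; suc; _<_; z≤n; s≤s; _≟_; _≤?_)
open import Data.Nat.Properties using (≤-refl; ≤-trans; m≤n⇒m≤1+n)
open import Data.Product using (_,_; proj₂; ∃₂; ∃-syntax)
open import Data.Sum using (_⊎_; inj₁; inj₂)
open import Data.Vec using (Vec; lookup; []; _∷_)
open import Function using (_∘_; id)
open import Relation.Binary.PropositionalEquality using (_≡_; _≢_; refl; sym; trans; cong; subst)
open import Relation.Nullary using (yes; no)

update-same : ∀ f i j → update f i (f i) j ≡ f j
update-same f i j with i ≟ j
... | yes refl = refl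
... | no _     = refl

initState-in : ∀ {n} (bs : Vec Bool n) {j} (j<n : j < n) →
               inS (initState bs) (suc j) ≡ lookup bs (fromℕ< j<n)
initState-in {n} bs {j} j<n with suc j ≤? n
... | yes _ = refl
... | no j≮n = ⊥-elim (j≮n j<n)

execBasic-in-range : ∀ {n i m s p} → execBasic n (inR i ∙ m) s ≡ just p → 1 ≤ i × i ≤ n
execBasic-in-range {n} {i} with 1 ≤? i | i ≤? n
... | yes 1≤i | yes i≤n = λ _ → 1≤i , i≤n
... | no _    | _       = λ ()
... | yes _   | no _    = λ ()

execBasic-get : ∀ {n i s s₁ r} → execBasic n (inR i ∙ get) s ≡ just (s₁ , r) →
                r ≡ inS s i × (∀ j → inS s₁ j ≡ inS s j) × outS s₁ ≡ outS s
execBasic-get {n} {i} {s} with 1 ≤? i | i ≤? n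
... | yes _ | yes _ = λ { refl → refl , update-same (inS s) i , refl }
... | no _  | _     = λ ()
... | yes _ | no _  = λ ()

execBasic-out-T : ∀ {n a s s₁ r} → a ≢ outR ∙ setF → execBasic n a s ≡ just (s₁ , r) →
                  outS s ≡ true → outS s₁ ≡ true
execBasic-out-T {n} {inR i ∙ m} {s} _ with 1 ≤? i | i ≤? n
... | yes _ | yes _ = λ { refl o → o }
... | no _  | _     = λ ()
... | yes _ | no _  = λ ()
execBasic-out-T {a = auxR i ∙ m} _ refl o = o
execBasic-out-T {a = outR ∙ setT} _ refl _ = refl
execBasic-out-T {a = outR ∙ setF} a≢setF _ _ = ⊥-elim (a≢setF refl)
execBasic-out-T {a = outR ∙ get} _ refl o = o

data Loc : Set where
  here next : Loc

at : Loc → InstrSeq → InstrSeq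
at here X = X
at next X = drop 1 X

basicOf : Instr → Maybe Basic
basicOf (plain a) = just a
basicOf (ptest a) = just a
basicOf (ntest a) = just a
basicOf (jump _)  = nothing
basicOf halt      = nothing

BasicsOf-basicOf : ∀ {P u a} → BasicsOf P u → basicOf u ≡ just a → P a
BasicsOf-basicOf {u = plain _} p refl = p
BasicsOf-basicOf {u = ptest _} p refl = p
BasicsOf-basicOf {u = ntest _} p refl = p

proceed : Instr → Bool → Loc
proceed (ptest _) false = next
proceed (ntest _) true  = next
proceed _         _     = here

resume : Loc → Instr → Bool → Loc
resume next _ _ = here
resume here u r = proceed u r

-- No test skips on both replies.
resume-dichotomy : ∀ u l l′ {c c′} → c ≡ false → c′ ≡ true →
                   resume l u c ≡ here ⊎ resume l′ u c′ ≡ here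
resume-dichotomy _         next _    _    _    = inj₁ refl
resume-dichotomy _         here next _    _    = inj₂ refl
resume-dichotomy (plain _) here here _    _    = inj₁ refl
resume-dichotomy (ptest _) here here _    refl = inj₂ refl
resume-dichotomy (ntest _) here here refl _    = inj₁ refl
resume-dichotomy (jump _)  here here _    _    = inj₁ refl
resume-dichotomy halt      here here _    _    = inj₁ refl

All-at : ∀ {P : Instr → Set} l {X} → All P X → All P (at l X)
All-at here = id
All-at next = drop⁺ 1

countHalt-drop : ∀ l X → countHalt (drop l X) ≤ countHalt X
countHalt-drop zero    X              = ≤-refl
countHalt-drop (suc l) []             = z≤n
countHalt-drop (suc l) (halt ∷ X)     = m≤n⇒m≤1+n (countHalt-drop l X)
countHalt-drop (suc l) (plain _ ∷ X)  = countHalt-drop l X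
countHalt-drop (suc l) (ptest _ ∷ X)  = countHalt-drop l X
countHalt-drop (suc l) (ntest _ ∷ X)  = countHalt-drop l X
countHalt-drop (suc l) (jump _ ∷ X)   = countHalt-drop l X

countHalt-at : ∀ l X → countHalt (at l X) ≤ countHalt X
countHalt-at here X = ≤-refl
countHalt-at next X = countHalt-drop 1 X

data Step (n : ℕ) : InstrSeq → State → InstrSeq → State → Set where
  jump-step  : ∀ {l X s} → Step n (jump (suc l) ∷ X) s (drop l X) s
  basic-step : ∀ {u a X s s₁ r} → basicOf u ≡ just a → execBasic n a s ≡ just (s₁ , r) →
               Step n (u ∷ X) s (at (proceed u r) X) s₁

data Terminates (n : ℕ) : InstrSeq → State → State → Set where
  stop : ∀ {X s} → Terminates n (halt ∷ X) s s
  step : ∀ {X X₁ s s₁ s′} → Step n X s X₁ s₁ → Terminates n X₁ s₁ s′ → Terminates n X s s′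

run⇒Terminates : ∀ {n} k X {s s′} → run k n X s ≡ terminated s′ → Terminates n X s s′
run⇒Terminates zero    X                  = λ ()
run⇒Terminates (suc k) []                 = λ ()
run⇒Terminates (suc k) (halt ∷ X)         = λ { refl → stop }
run⇒Terminates (suc k) (jump zero ∷ X)    = λ ()
run⇒Terminates (suc k) (jump (suc l) ∷ X) = step jump-step ∘ run⇒Terminates k (drop l X)
run⇒Terminates {n} (suc k) (plain a ∷ X) {s} with execBasic n a s in e
... | nothing          = λ ()
... | just (_ , _)     = step (basic-step refl e) ∘ run⇒Terminates k X
run⇒Terminates {n} (suc k) (ptest a ∷ X) {s} with execBasic n a s in e
... | nothing          = λ ()
... | just (_ , true)  = step (basic-step refl e) ∘ run⇒Terminates k X
... | just (_ , false) = step (basic-step refl e) ∘ run⇒Terminates k (drop 1 X)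
run⇒Terminates {n} (suc k) (ntest a ∷ X) {s} with execBasic n a s in e
... | nothing          = λ ()
... | just (_ , false) = step (basic-step refl e) ∘ run⇒Terminates k X
... | just (_ , true)  = step (basic-step refl e) ∘ run⇒Terminates k (drop 1 X)

¬Terminates-[] : ∀ {n s s′} → ¬ Terminates n [] s s′
¬Terminates-[] (step () _)

¬Terminates-#0 : ∀ {n X s s′} → ¬ Terminates n (jump zero ∷ X) s s′
¬Terminates-#0 (step (basic-step () _) _)

Terminates-halt : ∀ {n X s s′} → Terminates n (halt ∷ X) s s′ → s ≡ s′
Terminates-halt stop                        = refl
Terminates-halt (step (basic-step () _) _)

Terminates-basic : ∀ {n u a X s s′} → basicOf u ≡ just a → Terminates n (u ∷ X) s s′ →
                   ∃₂ λ s₁ r → execBasic n a s ≡ just (s₁ , r) × Terminates n (at (proceed u r) X) s₁ s′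
Terminates-basic () stop
Terminates-basic () (step jump-step _)
Terminates-basic b (step (basic-step b′ e) t) with trans (sym b) b′
... | refl = _ , _ , e , t

countHalt-step : ∀ {n X s X₁ s₁} → Step n X s X₁ s₁ → countHalt X₁ ≤ countHalt X
countHalt-step (jump-step {l} {X})                          = countHalt-drop l X
countHalt-step (basic-step {u = plain _} _ _)                = ≤-refl
countHalt-step (basic-step {u = ptest a} {X = X} {r = r} _ _) = countHalt-at (proceed (ptest a) r) X
countHalt-step (basic-step {u = ntest a} {X = X} {r = r} _ _) = countHalt-at (proceed (ntest a) r) X

Terminates⇒1≤countHalt : ∀ {n X s s′} → Terminates n X s s′ → 1 ≤ countHalt X
Terminates⇒1≤countHalt stop         = s≤s z≤n
Terminates⇒1≤countHalt (step first rest) = ≤-trans (Terminates⇒1≤countHalt rest) (countHalt-step first)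

Terminates-out-T : ∀ {n X s s′} → DoesNotOccur (outR ∙ setF) X → Terminates n X s s′ →
                   outS s ≡ true → outS s′ ≡ true
Terminates-out-T _ stop o = o
Terminates-out-T (_ ∷ ds) (step (jump-step {l}) t) o = Terminates-out-T (drop⁺ l ds) t o
Terminates-out-T (d ∷ ds) (step (basic-step {u = u} {r = r} b e) t) o =
  Terminates-out-T (All-at (proceed u r) ds) t (execBasic-out-T (BasicsOf-basicOf d b) e o)

-- Only in and out are constrained: the programs considered never touch aux.
record Run (n : ℕ) (X : InstrSeq) (bs : Vec Bool n) (g : Bool) : Set where
  field
    start end  : State
    terminates : Terminates n X start end
    result     : outS end ≡ g
    inputs     : ∀ i → inS start i ≡ inS (initState bs) i
    out-F      : outS start ≡ false
open Run

Computes⇒Run : ∀ {n f X} → Computes n f X → ∀ bs → Run n X bs (f bs)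
Computes⇒Run {X = X} comp bs = let (s′ , e , res) = comp bs in record
  { start = initState bs ; end = s′ ; terminates = run⇒Terminates (suc (length X)) X e
  ; result = res ; inputs = λ _ → refl ; out-F = refl }

Run-get : ∀ {n u i Y bs g} → basicOf u ≡ just (inR i ∙ get) → ∀ l →
          Run n (at l (u ∷ Y)) bs g → Run n (at (resume l u (inS (initState bs) i)) Y) bs g
Run-get b next r = r
Run-get {n} {u} {i} {Y} b here r with Terminates-basic b (terminates r)
... | s₁ , _ , e , t with execBasic-get e
...   | refl , same-inputs , same-out = record
  { start = s₁ ; end = end r
  ; terminates = subst (λ c → Terminates n (at (proceed u c) Y) s₁ (end r)) (inputs r i) t
  ; result = result r
  ; inputs = λ j → trans (same-inputs j) (inputs r j)
  ; out-F = trans same-out (out-F r) }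

¬Run-out-setT : ∀ {n u Y bs} → basicOf u ≡ just (outR ∙ setT) → DoesNotOccur (outR ∙ setF) Y →
                ¬ Run n (u ∷ Y) bs false
¬Run-out-setT {u = u} b ds r with Terminates-basic b (terminates r)
... | _ , c , refl , t with trans (sym (Terminates-out-T (All-at (proceed u c) ds) t refl)) (result r)
... | ()

¬Run-halt : ∀ {n Y bs} → countHalt Y ≤ 0 → ∀ l → ¬ Run n (at l (halt ∷ Y)) bs true
¬Run-halt _ here r with trans (sym (out-F r)) (trans (cong outS (Terminates-halt (terminates r))) (result r))
... | ()
¬Run-halt no-halt next r with ≤-trans (Terminates⇒1≤countHalt (terminates r)) no-halt
... | ()

¬Run-[] : ∀ {n bs g} l → ¬ Run n (at l []) bs g
¬Run-[] here = ¬Terminates-[] ∘ terminates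
¬Run-[] next = ¬Terminates-[] ∘ terminates

Satisfiable : ∀ {n} → (Vec Bool n → Bool) → Set
Satisfiable f = ∃[ bs ] f bs ≡ true

NoLiteralImplicant : ∀ {n} → (Vec Bool n → Bool) → Set
NoLiteralImplicant {n} f = ∀ (k : Fin n) b → ∃[ bs ] lookup bs k ≡ b × f bs ≡ false

record Executions {n} (f : Vec Bool n → Bool) (X : InstrSeq) : Set where
  field
    accepting : ∃₂ λ bs l → Run n (at l X) bs true
    rejecting : ∀ bs → f bs ≡ false → ∃[ l ] Run n (at l X) bs false
    live      : ∃[ bs ] Run n X bs false
open Executions

Executions-get : ∀ {n f u i Y} → NoLiteralImplicant f → basicOf u ≡ just (inR i ∙ get) →
                 Executions {n} f (u ∷ Y) → Executions f Y
Executions-get {n} {u = u} {Y = Y} nli b E with Terminates-basic b (terminates (proj₂ (live E)))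
... | _ , _ , e , _ with execBasic-in-range e
... | s≤s {n = j} z≤n , j<n = record
  { accepting = let (bs , l , r) = accepting E in bs , step-loc bs l , Run-get b l r
  ; rejecting = λ bs fbs → let (l , r) = rejecting E bs fbs in step-loc bs l , Run-get b l r
  ; live      = new-live }
  where
  k : Fin n
  k = fromℕ< j<n

  step-loc : Vec Bool n → Loc → Loc
  step-loc bs l = resume l u (inS (initState bs) (suc j))

  at-head : ∀ {bs} l → Run n (at l (u ∷ Y)) bs false →
            step-loc bs l ≡ here → ∃[ bs′ ] Run n Y bs′ false
  at-head {bs} l r e = bs , subst (λ l → Run n (at l Y) bs false) e (Run-get b l r)

  new-live : ∃[ bs ] Run n Y bs false
  new-live with nli k false | nli k true
  ... | bs⁰ , v⁰ , f⁰ | bs¹ , v¹ , f¹ with rejecting E bs⁰ f⁰ | rejecting E bs¹ f¹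
  ... | l⁰ , r⁰ | l¹ , r¹
    with resume-dichotomy u l⁰ l¹ (trans (initState-in bs⁰ j<n) v⁰) (trans (initState-in bs¹ j<n) v¹)
  ... | inj₁ e = at-head l⁰ r⁰ e
  ... | inj₂ e = at-head l¹ r¹ e

¬Executions-basic : ∀ {n f u a Y} → NoLiteralImplicant f → basicOf u ≡ just a →
                    AllowedBasic a → NotAux a → a ≢ outR ∙ setF → DoesNotOccur (outR ∙ setF) Y →
                    ¬ Executions {n} f Y → ¬ Executions f (u ∷ Y)
¬Executions-basic nli b (in-get _ _) _ _ _ ¬E = ¬E ∘ Executions-get nli b
¬Executions-basic _ _ (aux-get _ _)  () _ _ _
¬Executions-basic _ _ (aux-setT _ _) () _ _ _
¬Executions-basic _ _ (aux-setF _ _) () _ _ _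
¬Executions-basic _ b out-setT _ _ ds _ = ¬Run-out-setT b ds ∘ proj₂ ∘ live
¬Executions-basic _ _ out-setF _ ≢setF _ _ = ⊥-elim (≢setF refl)

¬Executions : ∀ {n} {f : Vec Bool n → Bool} → NoLiteralImplicant f → ∀ X →
              All (BasicsOf AllowedBasic) X → All (BasicsOf NotAux) X → All NoPosJump X →
              DoesNotOccur (outR ∙ setF) X → countHalt X ≤ 1 → ¬ Executions f X
¬Executions nli [] _ _ _ _ _ E = let (_ , l , r) = accepting E in ¬Run-[] l r
¬Executions nli (halt ∷ Y) _ _ _ _ (s≤s no-halt) E = let (_ , l , r) = accepting E in ¬Run-halt no-halt l r
¬Executions nli (jump zero ∷ Y) _ _ _ _ _ E = ¬Terminates-#0 (terminates (proj₂ (live E)))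
¬Executions nli (jump (suc l) ∷ Y) _ _ (() ∷ _) _ _
¬Executions nli (plain a ∷ Y) (al ∷ als) (na ∷ nas) (_ ∷ njs) (d ∷ ds) ch =
  ¬Executions-basic nli refl al na d ds (¬Executions nli Y als nas njs ds ch)
¬Executions nli (ptest a ∷ Y) (al ∷ als) (na ∷ nas) (_ ∷ njs) (d ∷ ds) ch =
  ¬Executions-basic nli refl al na d ds (¬Executions nli Y als nas njs ds ch)
¬Executions nli (ntest a ∷ Y) (al ∷ als) (na ∷ nas) (_ ∷ njs) (d ∷ ds) ch =
  ¬Executions-basic nli refl al na d ds (¬Executions nli Y als nas njs ds ch)

Computes⇒Executions : ∀ {n} {f : Vec Bool (suc n) → Bool} {X} → Satisfiable f → NoLiteralImplicant f →
                      Computes (suc n) f X → Executions f X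
Computes⇒Executions {f = f} {X} (bs , fbs) nli comp = record
  { accepting = bs , here , subst (Run _ _ bs) fbs (runs bs)
  ; rejecting = λ bs fbs → here , subst (Run _ _ bs) fbs (runs bs)
  ; live      = let (bs , _ , fbs) = nli zero true in bs , subst (Run _ _ bs) fbs (runs bs) }
  where
  runs : ∀ bs → Run _ X bs (f bs)
  runs = Computes⇒Run comp

-- For n = 0 the hypothesis NoLiteralImplicant is vacuous, and out.set:T ; ! computes the constant T.
¬Computes : ∀ {n} (f : Vec Bool (suc n) → Bool) → Satisfiable f → NoLiteralImplicant f →
            ¬ (Σ InstrSeq λ X → IS-br⁰⁰ X × countHalt X ≤ 1 × DoesNotOccur (outR ∙ setF) X
                              × Computes (suc n) f X)
¬Computes f sat nli (X , ((_ , als) , nas , njs) , ch , ds , comp) =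
  ¬Executions nli X als nas njs ds ch (Computes⇒Executions sat nli comp)

φ₃-noLiteralImplicant : NoLiteralImplicant (induced φ₃)
φ₃-noLiteralImplicant k false = false ∷ false ∷ false ∷ [] , lemma k , refl
  where
  lemma : ∀ k → lookup (false ∷ false ∷ false ∷ []) k ≡ false
  lemma zero = refl
  lemma (suc zero) = refl
  lemma (suc (suc zero)) = refl
φ₃-noLiteralImplicant zero true = true ∷ false ∷ false ∷ [] , refl , refl
φ₃-noLiteralImplicant (suc zero) true = false ∷ true ∷ false ∷ [] , refl , refl
φ₃-noLiteralImplicant (suc (suc zero)) true = false ∷ false ∷ true ∷ [] , refl , refl

proposition3 : ¬ (Σ InstrSeq λ X →
                   IS-br⁰⁰ X × countHalt X ≤ 1 × DoesNotOccur (outR ∙ setF) X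
                   × Computes 3 (induced φ₃) X)
proposition3 = ¬Computes (induced φ₃) (true ∷ true ∷ true ∷ [] , refl) φ₃-noLiteralImplicant
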